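{- For all positive integers $m,n$, the complete bipartite graph $K_{m,n}$ is a max-point-tolerance graph.
   Context: $G=(V,E)$ (finite, simple, undirected) is a max-point-tolerance graph if each vertex $u$ can be assigned a pair $(I_u,p_u)$, with $I_u$ a closed bounded real interval and $p_u\in I_u$, such that for distinct $u,v$, $uv\in E$ iff $\{p_u,p_v\}\subseteq I_u\cap I_v$. -}

module Defs where

open import Level using (Level; _⊔_) renaming (suc to lsuc)
open import Data.Nat using (ℕ)
open import Data.Fin using (Fin)
open import Data.Sum using (_⊎_; inj₁; inj₂)
open import Data.Product using (Σ; _×_; _,_; proj₁; proj₂)
open import Data.Unit using (⊤)
open import Data.Empty using (⊥)
open import Data.Rational using (ℚ; _≤_)
open import Relation.Binary.PropositionalEquality using (_≡_)
open import Relation.Nullary using (¬_)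
open import Function.Bundles using (_⇔_)

record Graph : Set₁ where
  field
    V     : Set
    Adj   : V → V → Set
    irrefl : ∀ v → ¬ Adj v v
    sym    : ∀ u v → Adj u v → Adj v u

record Interval : Set where
  constructor [_,_]⟨_⟩
  field
    lo  : ℚ
    hi  : ℚ
    lo≤hi : lo ≤ hi

_∈ᵢ_ : ℚ → Interval → Set
x ∈ᵢ I = Interval.lo I ≤ x × x ≤ Interval.hi I

_∈∩_,_ : ℚ → Interval → Interval → Set
x ∈∩ I , J = x ∈ᵢ I × x ∈ᵢ J

record MPTRep (G : Graph) : Set where
  open Graph G
  field
    I    : V → Interval
    p    : V → ℚ
    p∈I  : ∀ u → p u ∈ᵢ I u
    edge : ∀ u v → ¬ u ≡ v →
           Adj u v ⇔ (p u ∈∩ I u , I v × p v ∈∩ I u , I v)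

IsMPT : Graph → Set
IsMPT G = MPTRep G

KAdj : (m n : ℕ) → Fin m ⊎ Fin n → Fin m ⊎ Fin n → Set
KAdj m n (inj₁ _) (inj₁ _) = ⊥
KAdj m n (inj₁ _) (inj₂ _) = ⊤
KAdj m n (inj₂ _) (inj₁ _) = ⊤
KAdj m n (inj₂ _) (inj₂ _) = ⊥

KAdj-irrefl : ∀ m n v → ¬ KAdj m n v v
KAdj-irrefl m n (inj₁ _) ()
KAdj-irrefl m n (inj₂ _) ()

KAdj-sym : ∀ m n u v → KAdj m n u v → KAdj m n v u
KAdj-sym m n (inj₁ _) (inj₂ _) _ = _
KAdj-sym m n (inj₂ _) (inj₁ _) _ = _

K : ℕ → ℕ → Graph
K m n = record { V = Fin m ⊎ Fin n ; Adj = KAdj m n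
               ; irrefl = KAdj-irrefl m n ; sym = KAdj-sym m n }

-- Put the left vertex i at the point i with interval [i , m + n] and the right vertex k at the
-- point m + k with interval [0 , m + k]. Every left interval reaches past all right points and
-- every right interval reaches back to all left points, so each cross pair sees both points.
-- On the left, j ∈ [i , m + n] and i ∈ [j , m + n] force i = j; on the right, m + k ≤ m + l and
-- m + l ≤ m + k force k = l.
module Submission where

open import Defs
open import Data.Nat using (ℕ; _≤_; _+_; z≤n)
open import Data.Nat.Properties using (≤-refl; ≤-trans; ≤-antisym; <⇒≤; m≤m+n; +-monoʳ-≤; +-cancelˡ-≡)
open import Data.Nat.Coprimality using (1-coprimeTo)
import Data.Nat.Coprimality as Coprimality
open import Data.Integer using (+_; +≤+)
open import Data.Integer.Properties using (*-identityʳ; drop‿+≤+)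
import Data.Integer as ℤ
open import Data.Rational as ℚ using (ℚ; mkℚ; *≤*)
open import Data.Fin using (Fin; toℕ)
open import Data.Fin.Properties using (toℕ-injective; toℕ<n)
open import Data.Sum using (inj₁; inj₂)
open import Data.Product using (_×_; _,_; proj₁; proj₂)
open import Data.Empty using (⊥-elim)
open import Relation.Nullary using (¬_)
open import Function.Bundles using (_⇔_; mk⇔; Equivalence)
open import Relation.Binary.PropositionalEquality using (_≡_; cong; sym; subst₂)

ι : ℕ → ℚ
ι k = mkℚ (+ k) 0 (Coprimality.sym (1-coprimeTo k))

ι-mono-≤ : ∀ {a b} → a ≤ b → ι a ℚ.≤ ι b
ι-mono-≤ {a} {b} a≤b = *≤* (subst₂ ℤ._≤_ (sym (*-identityʳ (+ a))) (sym (*-identityʳ (+ b))) (+≤+ a≤b))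

ι-cancel-≤ : ∀ {a b} → ι a ℚ.≤ ι b → a ≤ b
ι-cancel-≤ {a} {b} (*≤* a≤b) = drop‿+≤+ (subst₂ ℤ._≤_ (*-identityʳ (+ a)) (*-identityʳ (+ b)) a≤b)

_∈[_,_] : ℕ → ℕ → ℕ → Set
x ∈[ a , b ] = a ≤ x × x ≤ b

-- The natural-number version of an MPT representation, with the edge condition already reduced
-- using p u ∈ I u: u v adjacent iff each point lies in the other vertex's interval.
record ℕMPTRep (G : Graph) : Set where
  open Graph G
  field
    lo pt hi : V → ℕ
    pt∈      : ∀ u → pt u ∈[ lo u , hi u ]
    edge     : ∀ u v → ¬ u ≡ v → Adj u v ⇔ (pt u ∈[ lo v , hi v ] × pt v ∈[ lo u , hi u ])

ℕMPTRep⇒MPTRep : ∀ {G} → ℕMPTRep G → MPTRep G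
ℕMPTRep⇒MPTRep {G} R = record { I = I ; p = p ; p∈I = p∈I ; edge = edge′ }
  where
  open Graph G
  open ℕMPTRep R

  I : V → Interval
  I u = [ ι (lo u) , ι (hi u) ]⟨ ι-mono-≤ (≤-trans (proj₁ (pt∈ u)) (proj₂ (pt∈ u))) ⟩

  p : V → ℚ
  p u = ι (pt u)

  ι-∈ : ∀ {x} u → x ∈[ lo u , hi u ] → ι x ∈ᵢ I u
  ι-∈ u (lo≤x , x≤hi) = ι-mono-≤ lo≤x , ι-mono-≤ x≤hi

  ι-∈⁻¹ : ∀ {x} u → ι x ∈ᵢ I u → x ∈[ lo u , hi u ]
  ι-∈⁻¹ u (lo≤x , x≤hi) = ι-cancel-≤ lo≤x , ι-cancel-≤ x≤hi

  p∈I : ∀ u → p u ∈ᵢ I u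
  p∈I u = ι-∈ u (pt∈ u)

  edge′ : ∀ u v → ¬ u ≡ v → Adj u v ⇔ (p u ∈∩ I u , I v × p v ∈∩ I u , I v)
  edge′ u v u≢v = mk⇔
    (λ uv → let (u∈v , v∈u) = to uv in (p∈I u , ι-∈ v u∈v) , (ι-∈ u v∈u , p∈I v))
    (λ ((_ , u∈v) , (v∈u , _)) → from (ι-∈⁻¹ v u∈v , ι-∈⁻¹ u v∈u))
    where open Equivalence (edge u v u≢v)

K-ℕMPTRep : ∀ m n → ℕMPTRep (K m n)
K-ℕMPTRep m n = record { lo = lo ; pt = pt ; hi = hi ; pt∈ = pt∈ ; edge = edge }
  where
  open Graph (K m n)

  lo pt hi : V → ℕ
  lo (inj₁ i) = toℕ i
  lo (inj₂ k) = 0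
  pt (inj₁ i) = toℕ i
  pt (inj₂ k) = m + toℕ k
  hi (inj₁ i) = m + n
  hi (inj₂ k) = m + toℕ k

  left≤ : ∀ (i : Fin m) c → toℕ i ≤ m + c
  left≤ i c = ≤-trans (<⇒≤ (toℕ<n i)) (m≤m+n m c)

  right≤ : ∀ (k : Fin n) → m + toℕ k ≤ m + n
  right≤ k = +-monoʳ-≤ m (<⇒≤ (toℕ<n k))

  pt∈ : ∀ u → pt u ∈[ lo u , hi u ]
  pt∈ (inj₁ i) = ≤-refl , left≤ i n
  pt∈ (inj₂ k) = z≤n , ≤-refl

  cross : ∀ i k → pt (inj₁ i) ∈[ lo (inj₂ k) , hi (inj₂ k) ] × pt (inj₂ k) ∈[ lo (inj₁ i) , hi (inj₁ i) ]
  cross i k = (z≤n , left≤ i (toℕ k)) , (left≤ i (toℕ k) , right≤ k)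

  edge : ∀ u v → ¬ u ≡ v → Adj u v ⇔ (pt u ∈[ lo v , hi v ] × pt v ∈[ lo u , hi u ])
  edge (inj₁ i) (inj₁ j) i≢j = mk⇔ ⊥-elim
    λ ((j≤i , _) , (i≤j , _)) → i≢j (cong inj₁ (toℕ-injective (≤-antisym i≤j j≤i)))
  edge (inj₂ k) (inj₂ l) k≢l = mk⇔ ⊥-elim
    λ ((_ , k≤l) , (_ , l≤k)) → k≢l (cong inj₂ (toℕ-injective (+-cancelˡ-≡ m _ _ (≤-antisym k≤l l≤k))))
  edge (inj₁ i) (inj₂ k) _ = mk⇔ (λ _ → cross i k) _
  edge (inj₂ k) (inj₁ i) _ = mk⇔ (λ _ → let (i∈k , k∈i) = cross i k in k∈i , i∈k) _

K-isMPT : ∀ m n → IsMPT (K m n)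
K-isMPT m n = ℕMPTRep⇒MPTRep (K-ℕMPTRep m n)

lemma2p6 : (m n : ℕ) → 1 ≤ m → 1 ≤ n → IsMPT (K m n)
lemma2p6 m n _ _ = K-isMPT m n
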